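{- Let $p$ be a prime and $\varphi$ an irreducible support map of length $\ell$ with $s\geq 1$ jumps. Write $\ell=qs+r$ with integers $q\geq 0$ and $1\leq r\leq s$. Then $$|\varphi|:=\sum_{i\in\mathbb{Z}/\ell\mathbb{Z}}\varphi(i)\geq \sum_{i=1}^{\ell}c_i\geq \frac{s(s+1)}{2}\cdot\frac{p^q-1}{p-1}+\frac{r(r+1)}{2}p^q,$$ where $(c_i)_{i\geq1}$ is the increasing enumeration of the set $F_s=\bigcup_{b\in E_s}\{p^jb:\ j\geq 0\}$ with $E_s=\{1\leq i\leq s+\lceil \frac{s}{p-1}-1\rceil:\ \gcd(i,p)=1\}$.
   Context: A map $\varphi:\mathbb{Z}/\ell\mathbb{Z}\to\mathbb{Z}_{>0}$ is a support map of length $\ell$ with $s$ jumps ($\ell\geq s$) if $\varphi(i+1)=p\varphi(i)$ for all $i$ except exactly $s$ pairwise distinct values $i_1,\dots,i_s$, for which $\varphi(i+1)<p\varphi(i)$. It is irreducible if it is injective. -}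

module Defs where

open import Data.Nat using (ℕ; zero; suc; _+_; _*_; _∸_; _^_; _≤_; _<_; _<?_)
open import Data.Nat.DivMod using (_/_; _mod_)
open import Data.Nat.GCD using (gcd)
open import Data.Fin using (Fin; toℕ)
open import Data.List using (List; length; filter; allFin; map)
open import Data.Nat.ListAction using (sum)
open import Data.Product using (Σ; _×_; ∃)
open import Data.Sum using (_⊎_)
open import Function.Definitions using (Injective)
open import Relation.Binary.PropositionalEquality using (_≡_)

-- cyclic successor on ℤ/ℓℤ ≅ Fin ℓ :  i ↦ i + 1 mod ℓ
csuc : ∀ {ℓ} → Fin ℓ → Fin ℓ
csuc {suc n} i = suc (toℕ i) mod suc n

total : ∀ {ℓ} → (Fin ℓ → ℕ) → ℕ
total {ℓ} φ = sum (map φ (allFin ℓ))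

jumpCount : (p : ℕ) → ∀ {ℓ} → (Fin ℓ → ℕ) → ℕ
jumpCount p {ℓ} φ = length (filter (λ i → φ (csuc i) <? p * φ i) (allFin ℓ))

record IsSupportMap (p ℓ s : ℕ) (φ : Fin ℓ → ℕ) : Set where
  field
    s≤ℓ      : s ≤ ℓ
    positive : ∀ i → 0 < φ i
    step     : ∀ i → (φ (csuc i) ≡ p * φ i) ⊎ (φ (csuc i) < p * φ i)
    jumps    : jumpCount p φ ≡ s

-- irreducible = injective
IsIrreducible : ∀ {ℓ} → (Fin ℓ → ℕ) → Set
IsIrreducible φ = Injective _≡_ _≡_ φ

-- ceiling division ⌈a / d⌉ (d ≥ 1; value for d = 0 irrelevant)
ceilDiv : ℕ → ℕ → ℕ
ceilDiv a zero    = 0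
ceilDiv a (suc d) = (a + d) / suc d

-- E_s = { 1 ≤ i ≤ s + ⌈s/(p-1) - 1⌉ : gcd(i,p) = 1 }   (for s ≥ 1, ⌈s/(p-1) - 1⌉ = ⌈s/(p-1)⌉ - 1)
InE : (p s i : ℕ) → Set
InE p s i = (1 ≤ i) × (i ≤ s + ceilDiv s (p ∸ 1) ∸ 1) × (gcd i p ≡ 1)

InF : (p s n : ℕ) → Set
InF p s n = Σ ℕ λ j → Σ ℕ λ b → InE p s b × (n ≡ p ^ j * b)

-- c is the increasing enumeration of F_s, indexed from 0 (c 0 = c_1 in the paper)
IsIncreasingEnumeration : (ℕ → Set) → (ℕ → ℕ) → Set
IsIncreasingEnumeration F c =
  (∀ i → c i < c (suc i)) × (∀ i → F (c i)) × (∀ n → F n → ∃ λ i → c i ≡ n)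

sumBelow : (ℕ → ℕ) → ℕ → ℕ
sumBelow c zero    = 0
sumBelow c (suc n) = sumBelow c n + c n

{-# OPTIONS --safe #-}
module Submission where

-- Write φ(i) = p^(a_i) w_i with p ∤ w_i.  A non-jump step multiplies by p and so keeps w_i,
-- hence every w_i is the p-free part at the target of one of the s jumps.  Replacing the
-- k-th smallest of these (at most s) values by the k-th p-free number (E_s consists of the
-- first s p-free numbers) lowers each φ(i), keeps the map injective and lands in F_s; so
-- |φ| dominates a sum of ℓ distinct elements of F_s, hence the sum of the ℓ smallest.
-- For the closed form: below p^j (i+1) there are at most s elements p^a b of F_s for each
-- exponent a < j, and for a ≥ j only the p^j y with 1 ≤ y ≤ i; thus c (j s + i) ≥ p^j (i+1),
-- and summing these bounds block by block gives the geometric expression.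

open import Defs
import Algebra.Properties.CommutativeSemigroup
open import Data.Fin using (Fin; toℕ; fromℕ<)
open import Data.Fin.Properties using (toℕ-fromℕ<; toℕ-injective; toℕ<n; toℕ≤n; injective⇒≤)
open import Data.List using (List; []; _∷_; length; map; filter; allFin)
open import Data.List.Properties using (length-map; map-∘; length-tabulate)
open import Data.List.Membership.Propositional using (_∈_)
open import Data.List.Membership.Propositional.Properties using (∈-map⁺; ∈-map⁻; ∈-filter⁺; ∈-allFin)
open import Data.List.Relation.Unary.All as All using (All; []; _∷_)
open import Data.List.Relation.Unary.All.Properties as All using (all-filter)
open import Data.List.Relation.Unary.AllPairs using ([]; _∷_)
open import Data.List.Relation.Unary.Any using (here; toSum)
open import Data.List.Relation.Unary.Unique.Propositional using (Unique)
import Data.List.Relation.Unary.Unique.Propositional.Properties as Unique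
open import Data.Nat
open import Data.Nat.Base using (nonTrivial⇒n>1)
open import Data.Nat.Divisibility
open import Data.Nat.DivMod
open import Data.Nat.GCD using (gcd; gcd[m,n]∣m; gcd[m,n]∣n; gcd-greatest)
open import Data.Nat.Induction using (<-rec)
open import Data.Nat.ListAction using (sum)
open import Data.Nat.Primality using (Prime; prime⇒irreducible; prime⇒nonTrivial)
open import Data.Nat.Properties
open import Data.Nat.Tactic.RingSolver using (solve-∀)
open import Data.List.Membership.DecPropositional _≟_ using (_∈?_)
open import Data.Product using (∃; ∃₂; _×_; _,_; proj₁; proj₂)
open import Data.Sum using (_⊎_; inj₁; inj₂; [_,_]; [_,_]′)
open import Function using (_∘_)
open import Level using (0ℓ)
open import Relation.Binary using (tri<; tri≈; tri>)
open import Relation.Binary.PropositionalEquality hiding ([_])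
open import Relation.Nullary using (Dec; yes; no; ¬_; ¬?; contradiction)
open import Relation.Unary using (Pred; Decidable; _⊆_)
open import Relation.Unary.Properties using (∁?)

open Algebra.Properties.CommutativeSemigroup +-commutativeSemigroup using (interchange; x∙yz≈y∙xz)

sumBelow-mono : ∀ {f g : ℕ → ℕ} → (∀ m → f m ≤ g m) → ∀ n → sumBelow f n ≤ sumBelow g n
sumBelow-mono f≤g zero    = z≤n
sumBelow-mono f≤g (suc n) = +-mono-≤ (sumBelow-mono f≤g n) (f≤g n)

sumBelow-monoʳ : ∀ f {m n} → m ≤ n → sumBelow f m ≤ sumBelow f n
sumBelow-monoʳ f {n = zero}  z≤n = z≤n
sumBelow-monoʳ f {n = suc n} m≤1+n with m≤n⇒m<n∨m≡n m≤1+n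
... | inj₂ refl  = ≤-refl
... | inj₁ m<1+n = ≤-trans (sumBelow-monoʳ f (s≤s⁻¹ m<1+n)) (m≤m+n _ _)

sumBelow-+ : ∀ f g n → sumBelow (λ m → f m + g m) n ≡ sumBelow f n + sumBelow g n
sumBelow-+ f g zero    = refl
sumBelow-+ f g (suc n) =
  trans (cong (_+ (f n + g n)) (sumBelow-+ f g n)) (interchange (sumBelow f n) (sumBelow g n) (f n) (g n))

indicator : {A : Set} → Dec A → ℕ
indicator (yes _) = 1
indicator (no _)  = 0

indicator-yes : {A : Set} (a? : Dec A) → A → indicator a? ≡ 1
indicator-yes (yes _) _ = refl
indicator-yes (no ¬a) a = contradiction a ¬a

indicator-no : {A : Set} (a? : Dec A) → ¬ A → indicator a? ≡ 0
indicator-no (yes a) ¬a = contradiction a ¬a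
indicator-no (no _)  _  = refl

indicator-mono : {A B : Set} → (A → B) → (a? : Dec A) (b? : Dec B) → indicator a? ≤ indicator b?
indicator-mono A⇒B (no _)  _       = z≤n
indicator-mono A⇒B (yes _) (yes _) = ≤-refl
indicator-mono A⇒B (yes a) (no ¬b) = contradiction (A⇒B a) ¬b

indicator-⊎ : {A B C : Set} → (A → B ⊎ C) → (a? : Dec A) (b? : Dec B) (c? : Dec C) →
              indicator a? ≤ indicator b? + indicator c?
indicator-⊎ A⇒B⊎C (no _)  _       _       = z≤n
indicator-⊎ A⇒B⊎C (yes _) (yes _) _       = s≤s z≤n
indicator-⊎ A⇒B⊎C (yes _) (no _)  (yes _) = s≤s z≤n
indicator-⊎ A⇒B⊎C (yes a) (no ¬b) (no ¬c) = contradiction (A⇒B⊎C a) [ ¬b , ¬c ]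

countBelow : {P : Pred ℕ 0ℓ} → Decidable P → ℕ → ℕ
countBelow P? = sumBelow (indicator ∘ P?)

module _ {P : Pred ℕ 0ℓ} (P? : Decidable P) where

  countBelow-mono : ∀ {m n} → m ≤ n → countBelow P? m ≤ countBelow P? n
  countBelow-mono = sumBelow-monoʳ _

  countBelow-suc : ∀ {n} → P n → countBelow P? (suc n) ≡ suc (countBelow P? n)
  countBelow-suc {n} pn = trans (cong (countBelow P? n +_) (indicator-yes (P? n) pn)) (+-comm _ 1)

  countBelow-suc-∁ : ∀ {n} → ¬ P n → countBelow P? (suc n) ≡ countBelow P? n
  countBelow-suc-∁ {n} ¬pn = trans (cong (countBelow P? n +_) (indicator-no (P? n) ¬pn)) (+-identityʳ _)

  countBelow-strict : ∀ {m n} → P m → m < n → countBelow P? m < countBelow P? n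
  countBelow-strict pm m<n = ≤-trans (≤-reflexive (sym (countBelow-suc pm))) (countBelow-mono m<n)

  countBelow-reflects-< : ∀ {m n} → countBelow P? m < countBelow P? n → m < n
  countBelow-reflects-< {m} {n} lt with m <? n
  ... | yes m<n = m<n
  ... | no m≮n  = contradiction (countBelow-mono (≮⇒≥ m≮n)) (<⇒≱ lt)

  countBelow-reflects-≤ : ∀ {m n} → P n → countBelow P? m ≤ countBelow P? n → m ≤ n
  countBelow-reflects-≤ {m} {n} pn le with m ≤? n
  ... | yes m≤n = m≤n
  ... | no m≰n  = contradiction (countBelow-strict pn (≰⇒> m≰n)) (≤⇒≯ le)

  countBelow-injective : ∀ {m n} → P m → P n → countBelow P? m ≡ countBelow P? n → m ≡ n
  countBelow-injective pm pn eq =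
    ≤-antisym (countBelow-reflects-≤ pn (≤-reflexive eq)) (countBelow-reflects-≤ pm (≤-reflexive (sym eq)))

countBelow-⊆ : {P Q : Pred ℕ 0ℓ} (P? : Decidable P) (Q? : Decidable Q) → P ⊆ Q →
               ∀ n → countBelow P? n ≤ countBelow Q? n
countBelow-⊆ P? Q? P⊆Q = sumBelow-mono (λ m → indicator-mono P⊆Q (P? m) (Q? m))

countBelow-≟ : ∀ x n → countBelow (_≟ x) n ≤ 1
countBelow-≟ x n = [ (λ eq → ≤-trans (≤-reflexive eq) z≤n) , (≤-reflexive ∘ proj₂) ]′ (zeroOrOne n)
  where
  zeroOrOne : ∀ n → countBelow (_≟ x) n ≡ 0 ⊎ (x < n × countBelow (_≟ x) n ≡ 1)
  zeroOrOne zero = inj₁ refl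
  zeroOrOne (suc n) with n ≟ x | zeroOrOne n
  ... | yes refl | inj₁ eq         = inj₂ (≤-refl , trans (+-comm _ 1) (cong suc eq))
  ... | yes refl | inj₂ (x<x , _)  = contradiction x<x (<-irrefl refl)
  ... | no _     | inj₁ eq         = inj₁ (trans (+-identityʳ _) eq)
  ... | no _     | inj₂ (x<n , eq) = inj₂ (m<n⇒m<1+n x<n , trans (+-identityʳ _) eq)

countBelow-∈ : ∀ (V : List ℕ) n → countBelow (_∈? V) n ≤ length V
countBelow-∈ []      zero    = z≤n
countBelow-∈ []      (suc n) = +-mono-≤ (countBelow-∈ [] n) z≤n
countBelow-∈ (x ∷ V) n = begin
  countBelow (_∈? x ∷ V) n
    ≤⟨ sumBelow-mono pointwise n ⟩
  sumBelow (λ m → indicator (m ≟ x) + indicator (m ∈? V)) n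
    ≡⟨ sumBelow-+ _ _ n ⟩
  countBelow (_≟ x) n + countBelow (_∈? V) n
    ≤⟨ +-mono-≤ (countBelow-≟ x n) (countBelow-∈ V n) ⟩
  suc (length V) ∎
  where
  open ≤-Reasoning
  pointwise : ∀ m → indicator (m ∈? x ∷ V) ≤ indicator (m ≟ x) + indicator (m ∈? V)
  pointwise m = indicator-⊎ toSum (m ∈? x ∷ V) (m ≟ x) (m ∈? V)

module Increasing {c : ℕ → ℕ} (c-step : ∀ i → c i < c (suc i)) where

  strictMono : ∀ {m n} → m < n → c m < c n
  strictMono {m} {suc n} m<1+n with m≤n⇒m<n∨m≡n (s≤s⁻¹ m<1+n)
  ... | inj₁ m<n  = <-trans (strictMono m<n) (c-step n)
  ... | inj₂ refl = c-step m

  mono : ∀ {m n} → m ≤ n → c m ≤ c n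
  mono m≤n with m≤n⇒m<n∨m≡n m≤n
  ... | inj₁ m<n  = <⇒≤ (strictMono m<n)
  ... | inj₂ refl = ≤-refl

  injective : ∀ {m n} → c m ≡ c n → m ≡ n
  injective {m} {n} eq with <-cmp m n
  ... | tri< m<n _ _ = contradiction eq (<⇒≢ (strictMono m<n))
  ... | tri≈ _ m≡n _ = m≡n
  ... | tri> _ _ n<m = contradiction (sym eq) (<⇒≢ (strictMono n<m))

module _ {A : Set} {P : Pred A 0ℓ} (P? : Decidable P) where

  sum-map-filter-∁ : ∀ (f : A → ℕ) xs →
                     sum (map f xs) ≡ sum (map f (filter P? xs)) + sum (map f (filter (∁? P?) xs))
  sum-map-filter-∁ f []       = refl
  sum-map-filter-∁ f (x ∷ xs) with P? x
  ... | yes _ = trans (cong (f x +_) (sum-map-filter-∁ f xs)) (sym (+-assoc (f x) (sum (map f (filter P? xs))) _))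
  ... | no _  = trans (cong (f x +_) (sum-map-filter-∁ f xs)) (x∙yz≈y∙xz (f x) (sum (map f (filter P? xs))) _)

  length-filter-∁ : ∀ xs → length xs ≡ length (filter P? xs) + length (filter (∁? P?) xs)
  length-filter-∁ []       = refl
  length-filter-∁ (x ∷ xs) with P? x
  ... | yes _ = cong suc (length-filter-∁ xs)
  ... | no _  = trans (cong suc (length-filter-∁ xs)) (sym (+-suc _ _))

sum-map-mono : {A : Set} {f g : A → ℕ} → (∀ x → f x ≤ g x) → ∀ xs → sum (map f xs) ≤ sum (map g xs)
sum-map-mono f≤g []       = z≤n
sum-map-mono f≤g (x ∷ xs) = +-mono-≤ (f≤g x) (sum-map-mono f≤g xs)

Unique-All-≡ : {A : Set} {b : A} {xs : List A} → Unique xs → All (_≡ b) xs → xs ≡ [] ⊎ xs ≡ b ∷ []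
Unique-All-≡ []                []                  = inj₁ refl
Unique-All-≡ (_ ∷ [])          (refl ∷ [])         = inj₂ refl
Unique-All-≡ ((x≢y ∷ _) ∷ _)   (x≡b ∷ y≡b ∷ _)     = contradiction (trans x≡b (sym y≡b)) x≢y

All-<-suc-sum : ∀ xs → All (_< suc (sum xs)) xs
All-<-suc-sum []       = []
All-<-suc-sum (x ∷ xs) =
  s≤s (m≤m+n x _) ∷ All.map (λ lt → ≤-trans lt (s≤s (m≤n+m _ x))) (All-<-suc-sum xs)

module _ (c : ℕ → ℕ) (c-mono : ∀ {m n} → m ≤ n → c m ≤ c n) where

  sumBelow-length≤sum-Unique : ∀ {xs} → Unique xs → sumBelow c (length xs) ≤ sum (map c xs)
  sumBelow-length≤sum-Unique {xs} u = proj₂ (bounded (suc (sum xs)) u (All-<-suc-sum xs))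
    where
    -- Induction on a strict upper bound B + 1 of the entries: at most one of them is not below B.
    bounded : ∀ B {xs} → Unique xs → All (_< B) xs →
              length xs ≤ B × sumBelow c (length xs) ≤ sum (map c xs)
    bounded zero    {[]}    _ _        = z≤n , z≤n
    bounded zero    {_ ∷ _} _ (() ∷ _)
    bounded (suc B) {xs} u xs<1+B =
      conclude (bounded B (Unique.filter⁺ (_<? B) u) (all-filter (_<? B) xs))
        (length-filter-∁ (_<? B) xs) (sum-map-filter-∁ (_<? B) c xs)
        (Unique-All-≡ (Unique.filter⁺ (∁? (_<? B)) u)
          (All.zipWith (λ (lt , ≮) → ≤-antisym (s≤s⁻¹ lt) (≮⇒≥ ≮))
            (All.filter⁺ (∁? (_<? B)) xs<1+B , all-filter (∁? (_<? B)) xs)))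
      where
      lo = filter (_<? B) xs
      conclude : ∀ {hi} → length lo ≤ B × sumBelow c (length lo) ≤ sum (map c lo) →
                 length xs ≡ length lo + length hi → sum (map c xs) ≡ sum (map c lo) + sum (map c hi) →
                 hi ≡ [] ⊎ hi ≡ B ∷ [] → length xs ≤ suc B × sumBelow c (length xs) ≤ sum (map c xs)
      conclude (len≤ , sum≤) len≡ sum≡ (inj₁ refl)
        rewrite len≡ | sum≡ | +-identityʳ (length lo) | +-identityʳ (sum (map c lo))
        = m≤n⇒m≤1+n len≤ , sum≤
      conclude (len≤ , sum≤) len≡ sum≡ (inj₂ refl)
        rewrite len≡ | sum≡ | +-comm (length lo) 1 | +-identityʳ (c B)
        = s≤s len≤ , +-mono-≤ sum≤ (c-mono len≤)

suc[m%n]%n≡suc[m]%n : ∀ m n .{{_ : NonZero n}} → suc (m % n) % n ≡ suc m % n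
suc[m%n]%n≡suc[m]%n m n = begin
  (1 + m % n) % n         ≡⟨ %-distribˡ-+ 1 (m % n) n ⟩
  (1 % n + m % n % n) % n ≡⟨ cong (λ k → (1 % n + k) % n) (m%n%n≡m%n m n) ⟩
  (1 % n + m % n) % n     ≡⟨ %-distribˡ-+ 1 m n ⟨
  (1 + m) % n             ∎
  where open ≡-Reasoning

csuc-induction : ∀ {n} (R : Fin (suc n) → Set) → (∀ i → R i → R (csuc i)) →
                 ∀ {i₀} → R i₀ → ∀ i → R i
csuc-induction {n} R step {i₀} Ri₀ i = reach (suc n ∸ toℕ i₀ + toℕ i) i (sym wrap)
  where
  open ≡-Reasoning
  t₀ = toℕ i₀
  reach : ∀ k i → toℕ i ≡ (t₀ + k) % suc n → R i
  reach zero    i eq = subst R (toℕ-injective (begin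
    t₀                 ≡⟨ m<n⇒m%n≡m (toℕ<n i₀) ⟨
    t₀ % suc n         ≡⟨ cong (_% suc n) (+-identityʳ t₀) ⟨
    (t₀ + 0) % suc n   ≡⟨ eq ⟨
    toℕ i              ∎)) Ri₀
  reach (suc k) i eq = subst R (toℕ-injective (begin
    toℕ (csuc j)                ≡⟨ toℕ-fromℕ< _ ⟩
    suc (toℕ j) % suc n         ≡⟨ cong (λ m → suc m % suc n) (toℕ-fromℕ< _) ⟩
    suc ((t₀ + k) % suc n) % suc n ≡⟨ suc[m%n]%n≡suc[m]%n (t₀ + k) (suc n) ⟩
    suc (t₀ + k) % suc n        ≡⟨ cong (_% suc n) (+-suc t₀ k) ⟨
    (t₀ + suc k) % suc n        ≡⟨ eq ⟨
    toℕ i                       ∎)) (step j (reach k j (toℕ-fromℕ< _)))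
    where j = fromℕ< (m%n<n (t₀ + k) (suc n))
  wrap : (t₀ + (suc n ∸ t₀ + toℕ i)) % suc n ≡ toℕ i
  wrap = begin
    (t₀ + (suc n ∸ t₀ + toℕ i)) % suc n ≡⟨ cong (_% suc n) (+-assoc t₀ _ (toℕ i)) ⟨
    (t₀ + (suc n ∸ t₀) + toℕ i) % suc n ≡⟨ cong (λ m → (m + toℕ i) % suc n) (m+[n∸m]≡n (toℕ≤n i₀)) ⟩
    (suc n + toℕ i) % suc n             ≡⟨ cong (_% suc n) (+-comm (suc n) (toℕ i)) ⟩
    (toℕ i + suc n) % suc n             ≡⟨ [m+n]%n≡m%n (toℕ i) (suc n) ⟩
    toℕ i % suc n                       ≡⟨ m<n⇒m%n≡m (toℕ<n i) ⟩
    toℕ i                               ∎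

module _ {F : ℕ → Set} {c : ℕ → ℕ} (enum : IsIncreasingEnumeration F c) where

  -- If c k < X, then c 0, …, c k are k + 1 elements of F below X, all coded injectively below k.
  enumeration-lowerBound : ∀ {X k} (code : ∀ {x} → F x → ℕ) →
                           (∀ {x y} (fx : F x) (fy : F y) → code fx ≡ code fy → x ≡ y) →
                           (∀ {x} (fx : F x) → x < X → code fx < k) →
                           X ≤ c k
  enumeration-lowerBound {X} {k} code code-injective code-< with X ≤? c k
  ... | yes X≤ck = X≤ck
  ... | no X≰ck  = contradiction (injective⇒≤ {f = index} index-injective) (<-irrefl refl)
    where
    open Increasing (proj₁ enum)
    index-< : (t : Fin (suc k)) → code (proj₁ (proj₂ enum) (toℕ t)) < k
    index-< t = code-< _ (≤-<-trans (mono (s≤s⁻¹ (toℕ<n t))) (≰⇒> X≰ck))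
    index : Fin (suc k) → Fin k
    index t = fromℕ< (index-< t)
    index-injective : ∀ {t t'} → index t ≡ index t' → t ≡ t'
    index-injective eq = toℕ-injective (injective (code-injective _ _
      (trans (sym (toℕ-fromℕ< _)) (trans (cong toℕ eq) (toℕ-fromℕ< _)))))

*+-injective : ∀ {s} .{{_ : NonZero s}} {a a' x x'} → x < s → x' < s →
               a * s + x ≡ a' * s + x' → a ≡ a' × x ≡ x'
*+-injective {s} {a} {a'} {x} {x'} x<s x'<s eq =
  *-cancelʳ-≡ a a' s (+-cancelʳ-≡ x (a * s) (a' * s) (trans eq (cong (a' * s +_) (sym x≡x')))) , x≡x'
  where
  open ≡-Reasoning
  x≡x' : x ≡ x'
  x≡x' = begin
    x                  ≡⟨ m<n⇒m%n≡m x<s ⟨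
    x % s              ≡⟨ [m+kn]%n≡m%n x a s ⟨
    (x + a * s) % s    ≡⟨ cong (_% s) (trans (+-comm x (a * s)) (trans eq (+-comm (a' * s) x'))) ⟩
    (x' + a' * s) % s  ≡⟨ [m+kn]%n≡m%n x' a' s ⟩
    x' % s             ≡⟨ m<n⇒m%n≡m x'<s ⟩
    x'                 ∎

sumBelow-blocks-lowerBound : ∀ b s (c : ℕ → ℕ) →
  (∀ j i → i < s → suc b ^ j * suc i ≤ c (j * s + i)) →
  ∀ j i → i ≤ s →
  s * (s + 1) * (suc b ^ j ∸ 1) + i * (i + 1) * suc b ^ j * b ≤ 2 * b * sumBelow c (j * s + i)
sumBelow-blocks-lowerBound b s c c≥ = bound
  where
  open ≤-Reasoning
  P = suc b
  pred[P*x]≡ : ∀ x → 0 < x → P * x ∸ 1 ≡ (x ∸ 1) + x * b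
  pred[P*x]≡ (suc x) _ = cong (x +_) (*-comm b (suc x))
  nextBlock : ∀ S E P b → S * (S + 1) * (E + P * b) + 0 ≡ S * (S + 1) * E + S * (S + 1) * P * b
  nextBlock = solve-∀
  nextTerm : ∀ S E i P b → S * (S + 1) * E + suc i * (suc i + 1) * P * b ≡
                           (S * (S + 1) * E + i * (i + 1) * P * b) + 2 * b * (P * suc i)
  nextTerm = solve-∀
  bound : ∀ j i → i ≤ s →
          s * (s + 1) * (P ^ j ∸ 1) + i * (i + 1) * P ^ j * b ≤ 2 * b * sumBelow c (j * s + i)
  bound zero    zero    _   = ≤-trans (≤-reflexive (trans (+-identityʳ _) (*-zeroʳ (s * (s + 1))))) z≤n
  bound (suc j) zero    _   = begin
    s * (s + 1) * (P ^ suc j ∸ 1) + 0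
      ≡⟨ cong (λ e → s * (s + 1) * e + 0) (pred[P*x]≡ (P ^ j) (m^n>0 P j)) ⟩
    s * (s + 1) * ((P ^ j ∸ 1) + P ^ j * b) + 0
      ≡⟨ nextBlock s (P ^ j ∸ 1) (P ^ j) b ⟩
    s * (s + 1) * (P ^ j ∸ 1) + s * (s + 1) * P ^ j * b
      ≤⟨ bound j s ≤-refl ⟩
    2 * b * sumBelow c (j * s + s)
      ≡⟨ cong (λ k → 2 * b * sumBelow c k) (trans (+-comm (j * s) s) (sym (+-identityʳ _))) ⟩
    2 * b * sumBelow c (suc j * s + 0) ∎
  bound j       (suc i) i<s = begin
    s * (s + 1) * (P ^ j ∸ 1) + suc i * (suc i + 1) * P ^ j * b
      ≡⟨ nextTerm s (P ^ j ∸ 1) i (P ^ j) b ⟩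
    (s * (s + 1) * (P ^ j ∸ 1) + i * (i + 1) * P ^ j * b) + 2 * b * (P ^ j * suc i)
      ≤⟨ +-mono-≤ (bound j i (<⇒≤ i<s)) (*-monoʳ-≤ (2 * b) (c≥ j i i<s)) ⟩
    2 * b * sumBelow c (j * s + i) + 2 * b * c (j * s + i)
      ≡⟨ *-distribˡ-+ (2 * b) (sumBelow c (j * s + i)) (c (j * s + i)) ⟨
    2 * b * sumBelow c (suc (j * s + i))
      ≡⟨ cong (λ k → 2 * b * sumBelow c k) (+-suc (j * s) i) ⟨
    2 * b * sumBelow c (j * s + suc i) ∎

-- Writing p = 2 + d makes p ∸ 1 reduce to suc d.
module PAdic (d : ℕ) where

  p : ℕ
  p = 2 + d

  p∤1 : p ∤ 1
  p∤1 = >⇒∤ (s≤s (s≤s z≤n))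

  p∤⇒>0 : ∀ {n} → p ∤ n → 0 < n
  p∤⇒>0 p∤n = n≢0⇒n>0 (λ n≡0 → p∤n (subst (p ∣_) (sym n≡0) (p ∣0)))

  p-adic-split : ∀ n → 0 < n → ∃₂ λ a w → p ∤ w × n ≡ p ^ a * w
  p-adic-split = <-rec _ split
    where
    split : ∀ n → (∀ {m} → m < n → 0 < m → ∃₂ λ a w → p ∤ w × m ≡ p ^ a * w) →
            0 < n → ∃₂ λ a w → p ∤ w × n ≡ p ^ a * w
    split n rec n>0 with p ∣? n
    ... | no p∤n = 0 , n , p∤n , sym (*-identityˡ n)
    ... | yes (divides (suc q) refl) with rec (m<m*n (suc q) p (s≤s (s≤s z≤n))) (s≤s z≤n)
    ... | a , w , p∤w , q≡ = suc a , w , p∤w , trans (cong (_* p) q≡) (x*y*z≡z*x*y (p ^ a) w p)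
      where x*y*z≡z*x*y : ∀ x y z → x * y * z ≡ z * x * y
            x*y*z≡z*x*y = solve-∀

  p∣p^[1+k]*x : ∀ k x → p ∣ p ^ suc k * x
  p∣p^[1+k]*x k x = ∣m⇒∣m*n x (m∣m*n (p ^ k))

  p-adic-unique : ∀ a b {w w'} → p ∤ w → p ∤ w' → p ^ a * w ≡ p ^ b * w' → a ≡ b × w ≡ w'
  p-adic-unique zero    zero    {w} {w'} _   _    eq = refl , trans (sym (*-identityˡ w)) (trans eq (*-identityˡ w'))
  p-adic-unique zero    (suc b) {w} {w'} p∤w _    eq =
    contradiction (subst (p ∣_) (trans (sym eq) (*-identityˡ w)) (p∣p^[1+k]*x b w')) p∤w
  p-adic-unique (suc a) zero    {w} {w'} _   p∤w' eq =
    contradiction (subst (p ∣_) (trans eq (*-identityˡ w')) (p∣p^[1+k]*x a w)) p∤w'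
  p-adic-unique (suc a) (suc b) {w} {w'} p∤w p∤w' eq
    with p-adic-unique a b p∤w p∤w' (*-cancelˡ-≡ _ _ p (trans (sym (*-assoc p (p ^ a) w)) (trans eq (*-assoc p (p ^ b) w'))))
  ... | refl , w≡w' = refl , w≡w'

  pFree? : ∀ n → Dec (p ∤ n)
  pFree? n = ¬? (p ∣? n)

  pFreeCount : ℕ → ℕ
  pFreeCount = countBelow pFree?

  p∤suc[u]+A*p : ∀ A u → suc u < p → p ∤ suc u + A * p
  p∤suc[u]+A*p A u u<p p∣ = >⇒∤ u<p (∣m+n∣m⇒∣n (subst (p ∣_) (+-comm (suc u) (A * p)) p∣) (n∣m*n A))

  pFreeCount-*p : ∀ A → pFreeCount (A * p) ≡ A * suc d
  pFreeCount-suc-+*p : ∀ A u → u ≤ suc d → pFreeCount (suc (u + A * p)) ≡ u + A * suc d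

  pFreeCount-*p zero    = refl
  pFreeCount-*p (suc A) = pFreeCount-suc-+*p A (suc d) ≤-refl

  pFreeCount-suc-+*p A zero    _   =
    trans (countBelow-suc-∁ pFree? (λ p∤ → p∤ (n∣m*n A))) (pFreeCount-*p A)
  pFreeCount-suc-+*p A (suc u) u≤ =
    trans (countBelow-suc pFree? (p∤suc[u]+A*p A u (s≤s u≤)))
          (cong suc (pFreeCount-suc-+*p A u (≤-trans (n≤1+n u) u≤)))

  -- The largest element s + ⌈s/(p-1)⌉ - 1 of E_s is the s-th p-free number.
  pFreeCount-suc-maxE : ∀ s' → pFreeCount (suc (suc s' + ceilDiv (suc s') (suc d) ∸ 1)) ≡ suc s'
  pFreeCount-suc-maxE s' = begin
    pFreeCount (suc (suc s' + ceilDiv (suc s') (suc d) ∸ 1))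
      ≡⟨ cong (λ k → pFreeCount (suc (suc s' + k ∸ 1))) ceil≡ ⟩
    pFreeCount (suc (suc s' + suc A ∸ 1))
      ≡⟨ cong (λ k → pFreeCount (suc (k ∸ 1))) (+-suc (suc s') A) ⟩
    pFreeCount (suc (suc s' + A))
      ≡⟨ cong (λ k → pFreeCount (suc (suc k + A))) s'≡ ⟩
    pFreeCount (suc (suc (t + A * suc d) + A))
      ≡⟨ cong (pFreeCount ∘ suc) (regroup t A d) ⟩
    pFreeCount (suc (suc t + A * p))
      ≡⟨ pFreeCount-suc-+*p A (suc t) (m%n<n s' (suc d)) ⟩
    suc t + A * suc d
      ≡⟨ cong suc s'≡ ⟨
    suc s' ∎
    where
    open ≡-Reasoning
    t = s' % suc d
    A = s' / suc d
    s'≡ : s' ≡ t + A * suc d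
    s'≡ = m≡m%n+[m/n]*n s' (suc d)
    regroup : ∀ t A e → suc (t + A * suc e) + A ≡ suc t + A * (2 + e)
    regroup = solve-∀
    shift : ∀ t A e → suc (t + A * suc e) + e ≡ t + suc A * suc e
    shift = solve-∀
    ceil≡ : ceilDiv (suc s') (suc d) ≡ suc A
    ceil≡ = begin
      (suc s' + d) / suc d               ≡⟨ cong (λ k → (suc k + d) / suc d) s'≡ ⟩
      (suc (t + A * suc d) + d) / suc d  ≡⟨ cong (_/ suc d) (shift t A d) ⟩
      (t + suc A * suc d) / suc d        ≡⟨ +-distrib-/-∣ʳ t (n∣m*n (suc A)) ⟩
      t / suc d + suc A * suc d / suc d  ≡⟨ cong₂ _+_ (m<n⇒m/n≡0 (m%n<n s' (suc d))) (m*n/n≡m (suc A) (suc d)) ⟩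
      suc A                              ∎

  InE⇒pFree : ∀ {s' e} → InE p (suc s') e → p ∤ e × pFreeCount e < suc s'
  InE⇒pFree {s'} {e} (_ , e≤ , gcd≡1) = p∤e , pFreeCount<
    where
    p∤e : p ∤ e
    p∤e p∣e = p∤1 (subst (p ∣_) gcd≡1 (gcd-greatest p∣e ∣-refl))
    pFreeCount< : pFreeCount e < suc s'
    pFreeCount< = subst (pFreeCount e <_) (pFreeCount-suc-maxE s') (countBelow-strict pFree? p∤e (s≤s e≤))

  pFree⇒InE : Prime p → ∀ {s' e} → p ∤ e → pFreeCount e < suc s' → InE p (suc s') e
  pFree⇒InE pr {s'} {e} p∤e pFreeCount< = p∤⇒>0 p∤e , e≤ , gcd≡1
    where
    e≤ : e ≤ suc s' + ceilDiv (suc s') (suc d) ∸ 1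
    e≤ = s≤s⁻¹ (countBelow-reflects-< pFree? (subst (pFreeCount e <_) (sym (pFreeCount-suc-maxE s')) pFreeCount<))
    gcd≡1 : gcd e p ≡ 1
    gcd≡1 with prime⇒irreducible pr (gcd[m,n]∣n e p)
    ... | inj₁ gcd≡1 = gcd≡1
    ... | inj₂ gcd≡p = contradiction (subst (_∣ e) gcd≡p (gcd[m,n]∣m e p)) p∤e

  pFreeCount-surjective : ∀ t → ∃ λ e → p ∤ e × pFreeCount e ≡ t
  pFreeCount-surjective zero    = 1 , p∤1 , countBelow-suc-∁ pFree? (λ p∤0 → p∤0 (p ∣0))
  pFreeCount-surjective (suc t) with pFreeCount-surjective t
  ... | e , p∤e , count≡t with p ∣? suc e
  ... | no p∤1+e = suc e , p∤1+e , trans (countBelow-suc pFree? p∤e) (cong suc count≡t)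
  ... | yes p∣1+e = suc (suc e) , p∤2+e ,
          trans (countBelow-suc-∁ pFree? (λ p∤1+e → p∤1+e p∣1+e))
                (trans (countBelow-suc pFree? p∤e) (cong suc count≡t))
    where p∤2+e : p ∤ suc (suc e)
          p∤2+e p∣2+e = p∤1 (∣m+n∣m⇒∣n (subst (p ∣_) (+-comm 1 (suc e)) p∣2+e) p∣1+e)

  module Compression (V : List ℕ) (V-pFree : ∀ {v} → v ∈ V → p ∤ v) where

    rank : ℕ → ℕ
    rank = countBelow (_∈? V)

    compress : ℕ → ℕ
    compress w = proj₁ (pFreeCount-surjective (rank w))

    compress-pFree : ∀ w → p ∤ compress w
    compress-pFree w = proj₁ (proj₂ (pFreeCount-surjective (rank w)))

    pFreeCount-compress : ∀ w → pFreeCount (compress w) ≡ rank w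
    pFreeCount-compress w = proj₂ (proj₂ (pFreeCount-surjective (rank w)))

    compress-≤ : ∀ {w} → w ∈ V → compress w ≤ w
    compress-≤ {w} w∈V = countBelow-reflects-≤ pFree? (V-pFree w∈V)
      (≤-trans (≤-reflexive (pFreeCount-compress w)) (countBelow-⊆ (_∈? V) pFree? V-pFree w))

    pFreeCount-compress-< : ∀ {w} → w ∈ V → pFreeCount (compress w) < length V
    pFreeCount-compress-< {w} w∈V = subst (_< length V) (sym (pFreeCount-compress w))
      (≤-trans (countBelow-strict (_∈? V) w∈V ≤-refl) (countBelow-∈ V (suc w)))

    compress-injective : ∀ {w w'} → w ∈ V → w' ∈ V → compress w ≡ compress w' → w ≡ w'
    compress-injective {w} {w'} w∈V w'∈V eq = countBelow-injective (_∈? V) w∈V w'∈V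
      (trans (sym (pFreeCount-compress w)) (trans (cong pFreeCount eq) (pFreeCount-compress w')))

  -- An element p^a b of F_s below p^j (i+1) is coded by a s + pFreeCount b if a < j and by
  -- (p^(a-j) b) - 1 otherwise; the codes are distinct and lie below j s + i.
  module BlockCode (s' j : ℕ) where

    s : ℕ
    s = suc s'

    code : ℕ → ℕ → ℕ
    code a b with a <? j
    ... | yes _ = a * s + pFreeCount b
    ... | no _  = j * s + (p ^ (a ∸ j) * b ∸ 1)

    p^a*b≡p^j*[p^[a∸j]*b] : ∀ {a} b → ¬ a < j → p ^ a * b ≡ p ^ j * (p ^ (a ∸ j) * b)
    p^a*b≡p^j*[p^[a∸j]*b] {a} b a≮j = begin
      p ^ a * b                 ≡⟨ cong (λ k → p ^ k * b) (m+[n∸m]≡n (≮⇒≥ a≮j)) ⟨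
      p ^ (j + (a ∸ j)) * b     ≡⟨ cong (_* b) (^-distribˡ-+-* p j (a ∸ j)) ⟩
      p ^ j * p ^ (a ∸ j) * b   ≡⟨ *-assoc (p ^ j) _ b ⟩
      p ^ j * (p ^ (a ∸ j) * b) ∎
      where open ≡-Reasoning

    p^k*b>0 : ∀ k {b} → p ∤ b → 0 < p ^ k * b
    p^k*b>0 k p∤b = *-mono-≤ (m^n>0 p k) (p∤⇒>0 p∤b)

    earlyCode< : ∀ {a x} → a < j → x < s → a * s + x < j * s
    earlyCode< {a} a<j x<s =
      ≤-trans (+-monoʳ-< (a * s) x<s) (≤-trans (≤-reflexive (+-comm (a * s) s)) (*-monoˡ-≤ s a<j))

    code-injective : ∀ {a b a' b'} → p ∤ b × pFreeCount b < s → p ∤ b' × pFreeCount b' < s →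
                     code a b ≡ code a' b' → p ^ a * b ≡ p ^ a' * b'
    code-injective {a} {b} {a'} {b'} (p∤b , b<) (p∤b' , b'<) eq with a <? j | a' <? j
    ... | yes _   | yes _ with *+-injective {a = a} {a' = a'} b< b'< eq
    ...   | refl , count≡ = cong (p ^ a *_) (countBelow-injective pFree? p∤b p∤b' count≡)
    code-injective (_ , b<) _ eq | yes a<j | no _ =
      contradiction eq (<⇒≢ (≤-trans (earlyCode< a<j b<) (m≤m+n (j * s) _)))
    code-injective _ (_ , b'<) eq | no _ | yes a'<j =
      contradiction (sym eq) (<⇒≢ (≤-trans (earlyCode< a'<j b'<) (m≤m+n (j * s) _)))
    code-injective {a} {b} {a'} {b'} (p∤b , _) (p∤b' , _) eq | no a≮j | no a'≮j = begin
      p ^ a * b                     ≡⟨ p^a*b≡p^j*[p^[a∸j]*b] b a≮j ⟩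
      p ^ j * (p ^ (a ∸ j) * b)     ≡⟨ cong (p ^ j *_) late≡ ⟩
      p ^ j * (p ^ (a' ∸ j) * b')   ≡⟨ p^a*b≡p^j*[p^[a∸j]*b] b' a'≮j ⟨
      p ^ a' * b'                   ∎
      where
      open ≡-Reasoning
      late≡ : p ^ (a ∸ j) * b ≡ p ^ (a' ∸ j) * b'
      late≡ = pred-injective {{>-nonZero (p^k*b>0 (a ∸ j) p∤b)}} {{>-nonZero (p^k*b>0 (a' ∸ j) p∤b')}}
                (+-cancelˡ-≡ (j * s) _ _ eq)

    code-< : ∀ {a b} i → p ∤ b × pFreeCount b < s → p ^ a * b < p ^ j * suc i → code a b < j * s + i
    code-< {a} {b} i (p∤b , b<) lt with a <? j
    ... | yes a<j = ≤-trans (earlyCode< a<j b<) (m≤m+n (j * s) i)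
    ... | no a≮j  = +-monoʳ-< (j * s) (subst (_≤ i) (sym (suc-pred y {{>-nonZero y>0}})) y≤i)
      where
      y = p ^ (a ∸ j) * b
      y>0 : 0 < y
      y>0 = p^k*b>0 (a ∸ j) p∤b
      y≤i : y ≤ i
      y≤i = s≤s⁻¹ (*-cancelˡ-< (p ^ j) y (suc i) (subst (_< p ^ j * suc i) (p^a*b≡p^j*[p^[a∸j]*b] b a≮j) lt))

    block-lowerBound : ∀ {c} → IsIncreasingEnumeration (InF p s) c → ∀ i → p ^ j * suc i ≤ c (j * s + i)
    block-lowerBound enum i = enumeration-lowerBound enum codeF codeF-injective codeF-<
      where
      codeF : ∀ {x} → InF p s x → ℕ
      codeF (a , b , _ , _) = code a b
      codeF-injective : ∀ {x y} (fx : InF p s x) (fy : InF p s y) → codeF fx ≡ codeF fy → x ≡ y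
      codeF-injective (a , b , b∈E , refl) (a' , b' , b'∈E , refl) =
        code-injective (InE⇒pFree b∈E) (InE⇒pFree b'∈E)
      codeF-< : ∀ {x} (fx : InF p s x) → x < p ^ j * suc i → codeF fx < j * s + i
      codeF-< (a , b , b∈E , refl) = code-< i (InE⇒pFree b∈E)

  module SupportMap (pr : Prime p) {n s' : ℕ} {φ : Fin (suc n) → ℕ}
                    (sm : IsSupportMap p (suc n) (suc s') φ) (irr : IsIrreducible φ) where
    open IsSupportMap sm

    exponent : Fin (suc n) → ℕ
    exponent i = proj₁ (p-adic-split (φ i) (positive i))

    pFreePart : Fin (suc n) → ℕ
    pFreePart i = proj₁ (proj₂ (p-adic-split (φ i) (positive i)))

    pFreePart-pFree : ∀ i → p ∤ pFreePart i
    pFreePart-pFree i = proj₁ (proj₂ (proj₂ (p-adic-split (φ i) (positive i))))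

    φ≡p^exponent*pFreePart : ∀ i → φ i ≡ p ^ exponent i * pFreePart i
    φ≡p^exponent*pFreePart i = proj₂ (proj₂ (proj₂ (p-adic-split (φ i) (positive i))))

    pFreePart-csuc : ∀ i → φ (csuc i) ≡ p * φ i → pFreePart (csuc i) ≡ pFreePart i
    pFreePart-csuc i eq = proj₂ (p-adic-unique (exponent (csuc i)) (suc (exponent i))
      (pFreePart-pFree (csuc i)) (pFreePart-pFree i)
      (trans (sym (φ≡p^exponent*pFreePart (csuc i)))
        (trans eq (trans (cong (p *_) (φ≡p^exponent*pFreePart i)) (sym (*-assoc p (p ^ exponent i) (pFreePart i)))))))

    jumpList : List (Fin (suc n))
    jumpList = filter (λ i → φ (csuc i) <? p * φ i) (allFin (suc n))

    jumpParts : List ℕ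
    jumpParts = map (pFreePart ∘ csuc) jumpList

    length-jumpParts : length jumpParts ≡ suc s'
    length-jumpParts = trans (length-map _ jumpList) jumps

    jumpParts-pFree : ∀ {v} → v ∈ jumpParts → p ∤ v
    jumpParts-pFree v∈ with ∈-map⁻ (pFreePart ∘ csuc) v∈
    ... | j , _ , refl = pFreePart-pFree (csuc j)

    pFreePart∈jumpParts : ∀ i → pFreePart i ∈ jumpParts
    pFreePart∈jumpParts = csuc-induction (λ i → pFreePart i ∈ jumpParts) next
      (∈-map⁺ (pFreePart ∘ csuc) (proj₂ someJump))
      where
      next : ∀ i → pFreePart i ∈ jumpParts → pFreePart (csuc i) ∈ jumpParts
      next i i∈ with step i
      ... | inj₁ eq = subst (_∈ jumpParts) (sym (pFreePart-csuc i eq)) i∈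
      ... | inj₂ lt = ∈-map⁺ (pFreePart ∘ csuc) (∈-filter⁺ (λ i → φ (csuc i) <? p * φ i) (∈-allFin i) lt)
      nonEmpty : ∀ {A : Set} (xs : List A) → 0 < length xs → ∃ (_∈ xs)
      nonEmpty (x ∷ _) _ = x , here refl
      someJump : ∃ (_∈ jumpList)
      someJump = nonEmpty jumpList (subst (0 <_) (sym jumps) (s≤s z≤n))

    open Compression jumpParts jumpParts-pFree

    ψ : Fin (suc n) → ℕ
    ψ i = p ^ exponent i * compress (pFreePart i)

    ψ≤φ : ∀ i → ψ i ≤ φ i
    ψ≤φ i = subst (ψ i ≤_) (sym (φ≡p^exponent*pFreePart i))
      (*-monoʳ-≤ (p ^ exponent i) (compress-≤ (pFreePart∈jumpParts i)))

    ψ∈F : ∀ i → InF p (suc s') (ψ i)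
    ψ∈F i = exponent i , compress (pFreePart i) ,
      pFree⇒InE pr (compress-pFree (pFreePart i))
        (subst (pFreeCount (compress (pFreePart i)) <_) length-jumpParts (pFreeCount-compress-< (pFreePart∈jumpParts i))) ,
      refl

    ψ-injective : ∀ {i i'} → ψ i ≡ ψ i' → i ≡ i'
    ψ-injective {i} {i'} eq
      with p-adic-unique (exponent i) (exponent i') (compress-pFree (pFreePart i)) (compress-pFree (pFreePart i')) eq
    ... | exponent≡ , compress≡ = irr (begin
      φ i                             ≡⟨ φ≡p^exponent*pFreePart i ⟩
      p ^ exponent i * pFreePart i    ≡⟨ cong₂ (λ a w → p ^ a * w) exponent≡ pFreePart≡ ⟩
      p ^ exponent i' * pFreePart i'  ≡⟨ φ≡p^exponent*pFreePart i' ⟨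
      φ i'                            ∎)
      where
      open ≡-Reasoning
      pFreePart≡ = compress-injective (pFreePart∈jumpParts i) (pFreePart∈jumpParts i') compress≡

    sumBelow≤total : ∀ {c} → IsIncreasingEnumeration (InF p (suc s')) c → sumBelow c (suc n) ≤ total φ
    sumBelow≤total {c} enum = begin
      sumBelow c (suc n)                        ≡⟨ cong (sumBelow c) length-indices ⟨
      sumBelow c (length indices)               ≤⟨ sumBelow-length≤sum-Unique c (Increasing.mono (proj₁ enum))
                                                     (Unique.map⁺ {f = index} index-injective (Unique.allFin⁺ (suc n))) ⟩
      sum (map c indices)                       ≡⟨ cong sum (map-∘ {g = c} {f = index} (allFin (suc n))) ⟨
      sum (map (c ∘ index) (allFin (suc n)))    ≤⟨ sum-map-mono (λ i → subst (_≤ φ i) (sym (c∘index≡ψ i)) (ψ≤φ i))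
                                                     (allFin (suc n)) ⟩
      total φ                                   ∎
      where
      open ≤-Reasoning
      index : Fin (suc n) → ℕ
      index i = proj₁ (proj₂ (proj₂ enum) (ψ i) (ψ∈F i))
      c∘index≡ψ : ∀ i → c (index i) ≡ ψ i
      c∘index≡ψ i = proj₂ (proj₂ (proj₂ enum) (ψ i) (ψ∈F i))
      index-injective : ∀ {i i'} → index i ≡ index i' → i ≡ i'
      index-injective {i} {i'} eq = ψ-injective (trans (sym (c∘index≡ψ i)) (trans (cong c eq) (c∘index≡ψ i')))
      indices : List ℕ
      indices = map index (allFin (suc n))
      length-indices : length indices ≡ suc n
      length-indices = trans (length-map index (allFin (suc n))) (length-tabulate (λ i → i))

proposition1p9 : (p : ℕ) → Prime p → (ℓ s : ℕ) → 1 ≤ s →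
  (φ : Fin ℓ → ℕ) → IsSupportMap p ℓ s φ → IsIrreducible φ →
  (q r : ℕ) → ℓ ≡ q * s + r → 1 ≤ r → r ≤ s →
  (c : ℕ → ℕ) → IsIncreasingEnumeration (InF p s) c →
  (sumBelow c ℓ ≤ total φ)
  × (s * (s + 1) * (p ^ q ∸ 1) + r * (r + 1) * p ^ q * (p ∸ 1)
      ≤ 2 * (p ∸ 1) * sumBelow c ℓ)
proposition1p9 zero pr with nonTrivial⇒n>1 0 {{prime⇒nonTrivial pr}}
... | ()
proposition1p9 (suc zero) pr with nonTrivial⇒n>1 1 {{prime⇒nonTrivial pr}}
... | s≤s ()
proposition1p9 (suc (suc d)) pr zero (suc s') _ φ sm _ _ _ _ _ _ _ _ with IsSupportMap.jumps sm
... | ()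
proposition1p9 (suc (suc d)) pr (suc n) (suc s') _ φ sm irr q r ℓ≡ _ r≤s c enum =
  PAdic.SupportMap.sumBelow≤total d pr sm irr enum ,
  ≤-trans (sumBelow-blocks-lowerBound (suc d) (suc s') c block-lowerBound q r r≤s)
          (≤-reflexive (cong (λ ℓ → 2 * suc d * sumBelow c ℓ) (sym ℓ≡)))
  where block-lowerBound = λ j i _ → PAdic.BlockCode.block-lowerBound d s' j enum i
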